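{- Let $\beta(D)$ denote the number of strong bridges of a strongly connected finite simple digraph $D$. Then: (1) there is a constant $c$ such that for every $N$ there exists a strongly connected digraph $D$ with $\beta(D)\ge N$ and $\mu(D)=c$ (so $\beta(D)$ can be arbitrarily large while $\mu(D)$ stays constant); (2) there is a constant $c'$ such that for every $N$ there exists a strongly connected digraph $D$ with $\beta(D)=c'$ and $\mu(D)\ge N$ (so $\mu(D)$ can be arbitrarily large while $\beta(D)$ stays constant).
   Context: A digraph $D=(V,A)$ has a finite vertex set and arcs that are ordered pairs of distinct vertices, with no parallel arcs. A strong bridge is an arc whose removal increases the number of strongly connected components. A shortest directed $x,y$-path is a directed path (distinct vertices) from $x$ to $y$ of minimum length. A set $S\subseteq V$ is a mutual-visibility set of $D$ if for all distinct $x,y\in S$ there exist a shortest directed $x,y$-path $P$ and a shortest directed $y,x$-path $Q$ such that $(S\cap V(P))\cup(S\cap V(Q))=\{x,y\}$; $\mu(D)$ is the maximum size of a mutual-visibility set. -}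

module Defs where

open import Data.Nat using (ℕ; zero; suc; _<_)
open import Data.Bool using (Bool; true; false; _∧_; not)
open import Data.Fin using (Fin; _≟_)
open import Data.Fin.Subset using (Subset; _∈_) renaming (∣_∣ to ∣_∣ˢ)
open import Data.List using (List; []; _∷_; length)
open import Data.List.Relation.Unary.Unique.Propositional using (Unique)
import Data.List.Membership.Propositional as LM
open import Data.Product using (Σ; ∃; _×_; _,_)
open import Data.Sum using (_⊎_)
open import Relation.Nullary using (¬_)
open import Relation.Nullary.Decidable using (⌊_⌋)
open import Relation.Binary.PropositionalEquality using (_≡_; refl)

-- A finite simple digraph on vertex set Fin n: an arc relation given by a
-- Boolean adjacency function (so no parallel arcs), with no loops.
record Digraph (n : ℕ) : Set where
  field
    adj      : Fin n → Fin n → Bool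
    loopless : ∀ v → adj v v ≡ false
open Digraph public

module _ {n : ℕ} (D : Digraph n) where

  Arc : Fin n → Fin n → Set
  Arc u v = adj D u v ≡ true

  data Walk : Fin n → Fin n → Set where
    stop : ∀ {x} → Walk x x
    step : ∀ {x y z} → Arc x y → Walk y z → Walk x z

  verts : ∀ {x y} → Walk x y → List (Fin n)
  verts {x} stop       = x ∷ []
  verts {x} (step _ w) = x ∷ verts w

  len : ∀ {x y} → Walk x y → ℕ
  len stop       = zero
  len (step _ w) = suc (len w)

  IsPath : ∀ {x y} → Walk x y → Set
  IsPath w = Unique (verts w)

  IsShortestPath : ∀ {x y} → Walk x y → Set
  IsShortestPath {x} {y} w =
    IsPath w × (∀ (w' : Walk x y) → IsPath w' → len w Data.Nat.≤ len w')

  Reach : Fin n → Fin n → Set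
  Reach x y = Walk x y

  StronglyConnected : Set
  StronglyConnected = ∀ x y → Reach x y

  MutReach : Fin n → Fin n → Set
  MutReach x y = Reach x y × Reach y x

  NumSCC : ℕ → Set
  NumSCC k = Σ (List (Fin n)) λ R →
      Unique R
    × (∀ {r s} → r LM.∈ R → s LM.∈ R → MutReach r s → r ≡ s)
    × (∀ v → Σ (Fin n) λ r → r LM.∈ R × MutReach v r)
    × length R ≡ k

  IsMutualVisibility : Subset n → Set
  IsMutualVisibility S = ∀ x y → x ∈ S → y ∈ S → ¬ x ≡ y →
    Σ (Walk x y) λ P → Σ (Walk y x) λ Q →
      IsShortestPath P × IsShortestPath Q ×
      (∀ v → v ∈ S → (v LM.∈ verts P ⊎ v LM.∈ verts Q) → (v ≡ x ⊎ v ≡ y))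

  MuIs : ℕ → Set
  MuIs m = (Σ (Subset n) λ S → IsMutualVisibility S × ∣ S ∣ˢ ≡ m)
         × (∀ S → IsMutualVisibility S → ∣ S ∣ˢ Data.Nat.≤ m)

deleteArc : ∀ {n} → Digraph n → Fin n → Fin n → Digraph n
adj (deleteArc D a b) u v = adj D u v ∧ not (⌊ u ≟ a ⌋ ∧ ⌊ v ≟ b ⌋)
loopless (deleteArc D a b) u with adj D u u | loopless D u
... | false | refl = refl

module _ {n : ℕ} (D : Digraph n) where

  IsStrongBridge : Fin n → Fin n → Set
  IsStrongBridge a b = Arc D a b ×
    Σ ℕ λ k → Σ ℕ λ k' → NumSCC D k × NumSCC (deleteArc D a b) k' × k < k'

  BetaIs : ℕ → Set
  BetaIs k = Σ (List (Fin n × Fin n)) λ L →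
      Unique L
    × (∀ a b → ((a , b) LM.∈ L → IsStrongBridge a b) × (IsStrongBridge a b → (a , b) LM.∈ L))
    × length L ≡ k

{-# OPTIONS --safe #-}
-- (1) The directed cycle C on n ≥ 2 vertices.  Deleting an arc (a , next a) leaves a digraph
-- on which the position counted from next a strictly increases along every arc, so it is
-- acyclic with n singleton components: each of the n arcs is a strong bridge.  The same fact
-- shows that walks x → y and y → x (x ≢ y) together visit every vertex, since a vertex z
-- missed by both would leave x and y mutually reachable after deleting the arc into z.  Hence
-- no three vertices are mutually visible, while the two ends of the arc last → zero are: the
-- path zero → last of length n − 1 is shortest because every arc raises the index by at most
-- one.  So μ = 2.
-- (2) The complete digraph on n ≥ 3 vertices: all single arcs are shortest paths, so every set
-- is mutually visible (μ = n), and deleting an arc (a , b) keeps it strongly connected through a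
-- third vertex, so β = 0.
module Submission where

open import Defs
open import Data.Nat using (ℕ; zero; suc; _≤_; _<_; _+_; z≤n; s≤s)
open import Data.Nat.Properties
  using ( ≤-refl; ≤-reflexive; ≤-trans; ≤-antisym; ≤-pred; _≤?_; ≰⇒>; <⇒≤; <-≤-trans; <-irrefl
        ; n≤1+n; n≤0⇒n≡0; 1+n≢n; m≤n+m; m+1+n≰m; m+[n∸m]≡n
        ; +-suc; +-identityʳ; +-monoʳ-≤; +-monoʳ-<; module ≤-Reasoning )
open import Data.Bool using (not)
open import Data.Bool.Properties using (∧-conicalˡ; ∧-conicalʳ)
open import Data.Fin using (Fin; zero; suc; _≟_; toℕ; fromℕ; inject₁)
open import Data.Fin.Properties using (any?; toℕ-injective; toℕ<n; toℕ-fromℕ; toℕ-inject₁)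
import Data.Fin.Properties as Fin
open import Data.Fin.Relation.Unary.Top using (View; view; ‵fromℕ; ‵inject₁; view-fromℕ; view-inject₁)
open import Data.Fin.Subset using (Subset; inside; outside; ⁅_⁆; _∪_; ⊤) renaming (_∈_ to _∈ˢ_; ∣_∣ to ∣_∣ˢ)
open import Data.Fin.Subset.Properties
  using (nonempty?; Empty-unique; ∣⊥∣≡0; ∣⊤∣≡n; ∣p∣≤n; ∣⁅x⁆∣≡1; p⊆q⇒∣p∣≤∣q∣; x∈p∪q⁺; x∈⁅x⁆; x∈⁅y⁆⇒x≡y)
  renaming (_∈?_ to _∈ˢ?_)
open import Data.Vec using ([]; _∷_; here; there)
open import Data.List using ([]; _∷_; allFin; map)
open import Data.List.Properties using (length-map; length-tabulate)
open import Data.List.Relation.Unary.All as All using (All; []; _∷_)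
open import Data.List.Relation.Unary.AllPairs using ([]; _∷_)
open import Data.List.Relation.Unary.Any as Any using (here; there)
open import Data.List.Relation.Unary.Unique.Propositional using (Unique)
open import Data.List.Relation.Unary.Unique.Propositional.Properties using (allFin⁺; map⁺)
open import Data.List.Membership.Propositional using (_∈_; _∉_)
open import Data.List.Membership.Propositional.Properties using (∈-allFin; ∈-map⁺; ∈-map⁻)
open import Data.Product using (Σ; _×_; _,_; proj₁; proj₂)
open import Data.Sum using (_⊎_; inj₁; inj₂; swap)
import Data.Sum as Sum
open import Function using (_∘_)
open import Relation.Nullary using (¬_; contradiction; yes; no)
open import Relation.Nullary.Decidable using (⌊_⌋; _×-dec_; ¬?; decidable-stable)
open import Relation.Binary.PropositionalEquality using (_≡_; _≢_; refl; sym; trans; cong; cong₂; subst)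

private variable
  n : ℕ

Acyclic : Digraph n → Set
Acyclic D = ∀ {u v} → MutReach D u v → u ≡ v

record Ranking (D : Digraph n) : Set where
  field
    rank   : Fin n → ℕ
    rank-< : ∀ {u v} → Arc D u v → rank u < rank v

ShortestPath : Digraph n → Fin n → Fin n → Set
ShortestPath D x y = Σ (Walk D x y) (IsShortestPath D)

module _ {D : Digraph n} where

  _++ʷ_ : ∀ {x y z} → Walk D x y → Walk D y z → Walk D x z
  stop      ++ʷ w = w
  step e w₁ ++ʷ w = step e (w₁ ++ʷ w)

  start∈verts : ∀ {x y} (w : Walk D x y) → x ∈ verts D w
  start∈verts stop       = here refl
  start∈verts (step _ _) = here refl

  arc⇒≢ : ∀ {x y} → Arc D x y → x ≢ y
  arc⇒≢ {x} e refl with () ← trans (sym e) (loopless D x)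

  arc-isShortestPath : ∀ {x y} (e : Arc D x y) → IsShortestPath D (step e stop)
  arc-isShortestPath e = ((arc⇒≢ e ∷ []) ∷ [] ∷ []) , λ where
    stop       _ → contradiction refl (arc⇒≢ e)
    (step _ _) _ → s≤s z≤n

  module _ {a b : Fin n} where

    deleteArc⁺ : ∀ {u v} → Arc D u v → ¬ (u ≡ a × v ≡ b) → Arc (deleteArc D a b) u v
    deleteArc⁺ {u} {v} e ¬ab with u ≟ a | v ≟ b
    ... | yes refl | yes refl = contradiction (refl , refl) ¬ab
    ... | yes _    | no _     rewrite e = refl
    ... | no _     | _        rewrite e = refl

    deleteArc⁻ : ∀ {u v} → Arc (deleteArc D a b) u v → Arc D u v × ¬ (u ≡ a × v ≡ b)
    deleteArc⁻ {u} {v} e with u ≟ a | v ≟ b | ∧-conicalʳ (adj D u v) _ e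
    ... | yes refl | yes refl | ()
    ... | yes _    | no v≢b   | _ = ∧-conicalˡ _ _ e , v≢b ∘ proj₂
    ... | no u≢a   | _        | _ = ∧-conicalˡ _ _ e , u≢a ∘ proj₁

    widen : ∀ {x y} → Walk (deleteArc D a b) x y → Walk D x y
    widen stop       = stop
    widen (step e w) = step (proj₁ (deleteArc⁻ e)) (widen w)

    verts-widen : ∀ {x y} (w : Walk (deleteArc D a b) x y) → verts D (widen w) ≡ verts (deleteArc D a b) w
    verts-widen stop               = refl
    verts-widen (step {x = x} _ w) = cong (x ∷_) (verts-widen w)

    len-widen : ∀ {x y} (w : Walk (deleteArc D a b) x y) → len D (widen w) ≡ len (deleteArc D a b) w
    len-widen stop       = refl
    len-widen (step _ w) = cong suc (len-widen w)

    restrict : ∀ {x y} (w : Walk D x y) → b ∉ verts D w → Walk (deleteArc D a b) x y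
    restrict stop       _   = stop
    restrict (step e w) b∉w =
      step (deleteArc⁺ e λ where (_ , refl) → b∉w (there (start∈verts w))) (restrict w (b∉w ∘ there))

module _ {D : Digraph n} (ranking : Ranking D) where

  open Ranking ranking

  rank-≤ : ∀ {x y} → Walk D x y → rank x ≤ rank y
  rank-≤ stop       = ≤-refl
  rank-≤ (step e w) = <⇒≤ (<-≤-trans (rank-< e) (rank-≤ w))

  rank-verts : ∀ {x y} (w : Walk D x y) → All (λ t → rank x ≤ rank t) (verts D w)
  rank-verts stop       = ≤-refl ∷ []
  rank-verts (step e w) = ≤-refl ∷ All.map (λ r → <⇒≤ (<-≤-trans (rank-< e) r)) (rank-verts w)

  ranking⇒acyclic : Acyclic D
  ranking⇒acyclic (stop , _)       = refl
  ranking⇒acyclic (step e w , w⁻¹) =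
    contradiction (<-≤-trans (rank-< e) (≤-trans (rank-≤ w) (rank-≤ w⁻¹))) (<-irrefl refl)

  ranking⇒isPath : ∀ {x y} (w : Walk D x y) → IsPath D w
  ranking⇒isPath stop       = [] ∷ []
  ranking⇒isPath (step e w) =
    All.map (λ r x≡t → <-irrefl (cong rank x≡t) (<-≤-trans (rank-< e) r)) (rank-verts w) ∷ ranking⇒isPath w

stronglyConnected∧NumSCC⇒≡1 : {D : Digraph (suc n)} → StronglyConnected D → ∀ {k} → NumSCC D k → k ≡ 1
stronglyConnected∧NumSCC⇒≡1 _ (_ , _ , _ , cover , refl) with cover zero
stronglyConnected∧NumSCC⇒≡1 _  ([] , _ , _ , _ , refl)     | _ , () , _
stronglyConnected∧NumSCC⇒≡1 _  (_ ∷ [] , _ , _ , _ , refl) | _ = refl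
stronglyConnected∧NumSCC⇒≡1 sc (r ∷ s ∷ _ , (r≢s ∷ _) ∷ _ , distinct , _ , refl) | _ =
  contradiction (distinct (here refl) (there (here refl)) (sc r s , sc s r)) r≢s

stronglyConnected⇒NumSCC1 : {D : Digraph (suc n)} → StronglyConnected D → NumSCC D 1
stronglyConnected⇒NumSCC1 sc =
  zero ∷ [] , [] ∷ [] , (λ where (here refl) (here refl) _ → refl) ,
  (λ v → zero , here refl , sc v zero , sc zero v) , refl

acyclic⇒NumSCC : {D : Digraph n} → Acyclic D → NumSCC D n
acyclic⇒NumSCC {n} acyclic =
  allFin n , allFin⁺ n , (λ _ _ → acyclic) , (λ v → v , ∈-allFin v , stop , stop) , length-tabulate (λ i → i)

stronglyConnected⇒¬IsStrongBridge : {D : Digraph (suc n)} {a b : Fin (suc n)} →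
  StronglyConnected D → StronglyConnected (deleteArc D a b) → ¬ IsStrongBridge D a b
stronglyConnected⇒¬IsStrongBridge sc sc⁻ (_ , _ , _ , c , c⁻ , k<k⁻)
  rewrite stronglyConnected∧NumSCC⇒≡1 sc c | stronglyConnected∧NumSCC⇒≡1 sc⁻ c⁻ = <-irrefl refl k<k⁻

acyclic⇒IsStrongBridge : {D : Digraph (suc (suc n))} {a b : Fin (suc (suc n))} →
  StronglyConnected D → Arc D a b → Acyclic (deleteArc D a b) → IsStrongBridge D a b
acyclic⇒IsStrongBridge sc e acyclic =
  e , 1 , _ , stronglyConnected⇒NumSCC1 sc , acyclic⇒NumSCC acyclic , s≤s (s≤s z≤n)

∣p∪q∣≤∣p∣+∣q∣ : (p q : Subset n) → ∣ p ∪ q ∣ˢ ≤ ∣ p ∣ˢ + ∣ q ∣ˢ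
∣p∪q∣≤∣p∣+∣q∣ []            []            = z≤n
∣p∪q∣≤∣p∣+∣q∣ (inside ∷ p)  (inside ∷ q)  = s≤s (≤-trans (∣p∪q∣≤∣p∣+∣q∣ p q) (+-monoʳ-≤ ∣ p ∣ˢ (n≤1+n _)))
∣p∪q∣≤∣p∣+∣q∣ (inside ∷ p)  (outside ∷ q) = s≤s (∣p∪q∣≤∣p∣+∣q∣ p q)
∣p∪q∣≤∣p∣+∣q∣ (outside ∷ p) (inside ∷ q)  = ≤-trans (s≤s (∣p∪q∣≤∣p∣+∣q∣ p q)) (≤-reflexive (sym (+-suc _ _)))
∣p∪q∣≤∣p∣+∣q∣ (outside ∷ p) (outside ∷ q) = ∣p∪q∣≤∣p∣+∣q∣ p q

⊆pair⇒∣p∣≤2 : ∀ {p : Subset n} {x y} → (∀ {z} → z ∈ˢ p → z ≡ x ⊎ z ≡ y) → ∣ p ∣ˢ ≤ 2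
⊆pair⇒∣p∣≤2 {p = p} {x} {y} p⊆xy = begin
  ∣ p ∣ˢ                  ≤⟨ p⊆q⇒∣p∣≤∣q∣ (x∈p∪q⁺ {p = ⁅ x ⁆} ∘ Sum.map x≡y⇒x∈⁅y⁆ x≡y⇒x∈⁅y⁆ ∘ p⊆xy) ⟩
  ∣ ⁅ x ⁆ ∪ ⁅ y ⁆ ∣ˢ       ≤⟨ ∣p∪q∣≤∣p∣+∣q∣ ⁅ x ⁆ ⁅ y ⁆ ⟩
  ∣ ⁅ x ⁆ ∣ˢ + ∣ ⁅ y ⁆ ∣ˢ  ≡⟨ cong₂ _+_ (∣⁅x⁆∣≡1 x) (∣⁅x⁆∣≡1 y) ⟩
  2                       ∎
  where
    open ≤-Reasoning
    x≡y⇒x∈⁅y⁆ : ∀ {z w : Fin n} → z ≡ w → z ∈ˢ ⁅ w ⁆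
    x≡y⇒x∈⁅y⁆ refl = x∈⁅x⁆ _

∣p∣≤2 : ∀ {p : Subset n} → (∀ {x y z} → x ∈ˢ p → y ∈ˢ p → z ∈ˢ p → x ≢ y → z ≡ x ⊎ z ≡ y) → ∣ p ∣ˢ ≤ 2
∣p∣≤2 {n} {p} spanned with nonempty? p
... | no ∄x = ≤-trans (≤-reflexive (trans (cong ∣_∣ˢ (Empty-unique ∄x)) (∣⊥∣≡0 n))) z≤n
... | yes (x , x∈p) with any? (λ y → y ∈ˢ? p ×-dec ¬? (y ≟ x))
...   | yes (y , y∈p , y≢x) = ⊆pair⇒∣p∣≤2 λ z∈p → spanned x∈p y∈p z∈p (y≢x ∘ sym)
...   | no ∄y = ⊆pair⇒∣p∣≤2 {y = x} λ {z} z∈p →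
  inj₁ (decidable-stable (z ≟ x) λ z≢x → ∄y (z , z∈p , z≢x))

pair-isMutualVisibility : ∀ {D : Digraph n} {S s t} → (∀ {v} → v ∈ˢ S → v ≡ s ⊎ v ≡ t) →
  ShortestPath D s t → ShortestPath D t s → IsMutualVisibility D S
pair-isMutualVisibility S⊆st (P , P-sp) (Q , Q-sp) x y x∈S y∈S x≢y with S⊆st x∈S | S⊆st y∈S
... | inj₁ refl | inj₁ refl = contradiction refl x≢y
... | inj₂ refl | inj₂ refl = contradiction refl x≢y
... | inj₁ refl | inj₂ refl = P , Q , P-sp , Q-sp , λ _ v∈S _ → S⊆st v∈S
... | inj₂ refl | inj₁ refl = Q , P , Q-sp , P-sp , λ _ v∈S _ → swap (S⊆st v∈S)

adjacent⇒isMutualVisibility : ∀ {D : Digraph n} → (∀ {x y} → x ≢ y → Arc D x y) → ∀ S → IsMutualVisibility D S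
adjacent⇒isMutualVisibility adjacent _ x y _ _ x≢y =
  step xy stop , step yx stop , arc-isShortestPath xy , arc-isShortestPath yx ,
  λ _ _ → Sum.[ ends , swap ∘ ends ]
  where
    xy = adjacent x≢y
    yx = adjacent (x≢y ∘ sym)
    ends : ∀ {u v w} → w ∈ u ∷ v ∷ [] → w ≡ u ⊎ w ≡ v
    ends (here w≡u)         = inj₁ w≡u
    ends (there (here w≡v)) = inj₂ w≡v

module DirectedCycle (k : ℕ) where

  last : Fin (suc (suc k))
  last = fromℕ (suc k)

  next-view : ∀ {i : Fin (suc (suc k))} → View i → Fin (suc (suc k))
  next-view ‵fromℕ       = zero
  next-view (‵inject₁ j) = suc j

  next : Fin (suc (suc k)) → Fin (suc (suc k))
  next i = next-view (view i)

  next-last : next last ≡ zero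
  next-last = cong next-view (view-fromℕ (suc k))

  next-surjective : ∀ v → Σ (Fin (suc (suc k))) λ u → next u ≡ v
  next-surjective zero    = last , next-last
  next-surjective (suc j) = inject₁ j , cong next-view (view-inject₁ j)

  next-injective : ∀ {u v} → next u ≡ next v → u ≡ v
  next-injective {u} {v} e with view u | view v
  ... | ‵fromℕ       | ‵fromℕ       = refl
  ... | ‵inject₁ i   | ‵inject₁ j   = cong inject₁ (Fin.suc-injective e)

  next-irrefl : ∀ u → u ≢ next u
  next-irrefl u u≡next with view u
  ... | ‵inject₁ j = 1+n≢n (trans (cong toℕ (sym u≡next)) (toℕ-inject₁ j))

  toℕ≤toℕ-last : ∀ u → toℕ u ≤ toℕ last
  toℕ≤toℕ-last u = subst (toℕ u ≤_) (sym (toℕ-fromℕ (suc k))) (≤-pred (toℕ<n u))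

  toℕ-next : ∀ {u} → u ≢ last → toℕ (next u) ≡ suc (toℕ u)
  toℕ-next {u} u≢last with view u
  ... | ‵fromℕ       = contradiction refl u≢last
  ... | ‵inject₁ j   = cong suc (sym (toℕ-inject₁ j))

  toℕ-next≤ : ∀ u → toℕ (next u) ≤ suc (toℕ u)
  toℕ-next≤ u with view u
  ... | ‵fromℕ       = z≤n
  ... | ‵inject₁ j   = s≤s (≤-reflexive (sym (toℕ-inject₁ j)))

  C : Digraph (suc (suc k))
  adj C u v = ⌊ v ≟ next u ⌋
  loopless C v with v ≟ next v
  ... | yes v≡next = contradiction v≡next (next-irrefl v)
  ... | no _       = refl

  arc⁺ : ∀ {u v} → v ≡ next u → Arc C u v
  arc⁺ {u} {v} v≡next with v ≟ next u
  ... | yes _     = refl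
  ... | no v≢next = contradiction v≡next v≢next

  arc⁻ : ∀ {u v} → Arc C u v → v ≡ next u
  arc⁻ {u} {v} e with v ≟ next u
  ... | yes v≡next = v≡next

  arc-last : Arc C last zero
  arc-last = arc⁺ (sym next-last)

  toℕ≤len+toℕ : ∀ {u v} (w : Walk C u v) → toℕ v ≤ len C w + toℕ u
  toℕ≤len+toℕ stop = ≤-refl
  toℕ≤len+toℕ {u} (step e w) with refl ← arc⁻ e =
    ≤-trans (toℕ≤len+toℕ w) (≤-trans (+-monoʳ-≤ (len C w) (toℕ-next≤ u)) (≤-reflexive (+-suc _ _)))

  cutAt : Fin (suc (suc k)) → Digraph (suc (suc k))
  cutAt a = deleteArc C a (next a)

  -- toℕ b plus the position of u on the path b → ⋯ that remains of C once the arc into b is deleted.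
  potential : Fin (suc (suc k)) → Fin (suc (suc k)) → ℕ
  potential b u with toℕ b ≤? toℕ u
  ... | yes _ = toℕ u
  ... | no _  = suc (suc k) + toℕ u

  potential-step : ∀ {b u v} → toℕ v ≡ suc (toℕ u) → v ≢ b → potential b u < potential b v
  potential-step {b} {u} {v} v≡1+u v≢b with toℕ b ≤? toℕ u | toℕ b ≤? toℕ v
  ... | yes _   | yes _   = ≤-reflexive (sym v≡1+u)
  ... | yes b≤u | no b≰v  = contradiction (≤-trans b≤u (≤-trans (n≤1+n _) (≤-reflexive (sym v≡1+u)))) b≰v
  ... | no b≰u  | yes b≤v =
    contradiction (toℕ-injective (≤-antisym (subst (_≤ toℕ b) (sym v≡1+u) (≰⇒> b≰u)) b≤v)) v≢b
  ... | no _    | no _    = +-monoʳ-< (suc (suc k)) (≤-reflexive (sym v≡1+u))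

  potential-wrap : ∀ {b} → b ≢ zero → potential b last < potential b zero
  potential-wrap {b} b≢0 with toℕ b ≤? toℕ last | toℕ b ≤? 0
  ... | _         | yes b≤0 = contradiction (toℕ-injective (n≤0⇒n≡0 b≤0)) b≢0
  ... | yes _     | no _    = subst (toℕ last <_) (sym (+-identityʳ _)) (toℕ<n last)
  ... | no b≰last | no _    = contradiction (toℕ≤toℕ-last b) b≰last

  potential-next : ∀ {b u} → next u ≢ b → potential b u < potential b (next u)
  potential-next {b} {u} next≢b with view u
  ... | ‵fromℕ       = potential-wrap (next≢b ∘ sym)
  ... | ‵inject₁ j   = potential-step (cong suc (sym (toℕ-inject₁ j))) next≢b

  cutAt-ranking : ∀ a → Ranking (cutAt a)
  cutAt-ranking a = record { rank = potential (next a) ; rank-< = potential-mono }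
    where
      potential-mono : ∀ {u v} → Arc (cutAt a) u v → potential (next a) u < potential (next a) v
      potential-mono {u} {v} e with deleteArc⁻ {D = C} e
      ... | uv , ¬ab with refl ← arc⁻ {u} {v} uv =
        potential-next λ next≡ → ¬ab (next-injective next≡ , next≡)

  cutAt-acyclic : ∀ a → Acyclic (cutAt a)
  cutAt-acyclic a = ranking⇒acyclic (cutAt-ranking a)

  climb : ∀ d {u v} → toℕ u + d ≡ toℕ v → Walk (cutAt last) u v
  climb zero    {u} u+0≡v with refl ← toℕ-injective (trans (sym (+-identityʳ (toℕ u))) u+0≡v) = stop
  climb (suc d) {u} {v} u+1+d≡v =
    step (deleteArc⁺ {D = C} (arc⁺ refl) (u≢last ∘ proj₁))
         (climb d (trans (cong (_+ d) (toℕ-next u≢last)) (trans (sym (+-suc (toℕ u) d)) u+1+d≡v)))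
    where
      u≢last : u ≢ last
      u≢last refl = m+1+n≰m (toℕ last) (subst (_≤ toℕ last) (sym u+1+d≡v) (toℕ≤toℕ-last v))

  len-climb : ∀ d {u v} (u+d≡v : toℕ u + d ≡ toℕ v) → len (cutAt last) (climb d u+d≡v) ≡ d
  len-climb zero    {u} u+0≡v with refl ← toℕ-injective (trans (sym (+-identityʳ (toℕ u))) u+0≡v) = refl
  len-climb (suc d) _ = cong suc (len-climb d _)

  C-stronglyConnected : StronglyConnected C
  C-stronglyConnected u v =
    widen (climb _ (m+[n∸m]≡n (toℕ≤toℕ-last u))) ++ʷ step arc-last (widen (climb (toℕ v) {zero} refl))

  zero→last : ShortestPath C zero last
  zero→last =
    widen climbing ,
    subst Unique (sym (verts-widen climbing)) (ranking⇒isPath (cutAt-ranking last) climbing) ,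
    λ w _ → begin
      len C (widen climbing)    ≡⟨ len-widen climbing ⟩
      len (cutAt last) climbing ≡⟨ len-climb (toℕ last) {zero} refl ⟩
      toℕ last                  ≤⟨ toℕ≤len+toℕ w ⟩
      len C w + 0               ≡⟨ +-identityʳ _ ⟩
      len C w                   ∎
    where
      open ≤-Reasoning
      climbing : Walk (cutAt last) zero last
      climbing = climb (toℕ last) refl

  last→zero : ShortestPath C last zero
  last→zero = step arc-last stop , arc-isShortestPath arc-last

  roundTrip-covers : ∀ {x y} → x ≢ y → (P : Walk C x y) (Q : Walk C y x) → ∀ z → z ∈ verts C P ⊎ z ∈ verts C Q
  roundTrip-covers x≢y P Q z with Any.any? (z ≟_) (verts C P) | Any.any? (z ≟_) (verts C Q)
  ... | yes z∈P | _       = inj₁ z∈P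
  ... | no _    | yes z∈Q = inj₂ z∈Q
  ... | no z∉P  | no z∉Q with a , refl ← next-surjective z =
    contradiction (cutAt-acyclic a (restrict P z∉P , restrict Q z∉Q)) x≢y

  ends : Subset (suc (suc k))
  ends = inside ∷ ⁅ fromℕ k ⁆

  ends⊆ : ∀ {v} → v ∈ˢ ends → v ≡ zero ⊎ v ≡ last
  ends⊆ here      = inj₁ refl
  ends⊆ (there p) = inj₂ (cong suc (x∈⁅y⁆⇒x≡y (fromℕ k) p))

  C-μ : MuIs C 2
  C-μ = (ends , pair-isMutualVisibility ends⊆ zero→last last→zero , cong suc (∣⁅x⁆∣≡1 (fromℕ k))) ,
    λ S visible → ∣p∣≤2 λ x∈S y∈S z∈S x≢y →
      let (P , Q , _ , _ , only) = visible _ _ x∈S y∈S x≢y in only _ z∈S (roundTrip-covers x≢y P Q _)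

  C-β : BetaIs C (suc (suc k))
  C-β =
    map arcFrom (allFin _) , map⁺ (cong proj₁) (allFin⁺ _) , (λ a b → bridge , listed) ,
    trans (length-map arcFrom (allFin _)) (length-tabulate (λ i → i))
    where
      arcFrom : Fin (suc (suc k)) → Fin (suc (suc k)) × Fin (suc (suc k))
      arcFrom a = a , next a

      bridge : ∀ {a b} → (a , b) ∈ map arcFrom (allFin _) → IsStrongBridge C a b
      bridge a,b∈ with a , _ , refl ← ∈-map⁻ arcFrom a,b∈ =
        acyclic⇒IsStrongBridge C-stronglyConnected (arc⁺ refl) (cutAt-acyclic a)

      listed : ∀ {a b} → IsStrongBridge C a b → (a , b) ∈ map arcFrom (allFin _)
      listed {a} (e , _) with refl ← arc⁻ e = ∈-map⁺ arcFrom (∈-allFin a)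

complete : (n : ℕ) → Digraph n
adj (complete n) u v = not ⌊ u ≟ v ⌋
loopless (complete n) v with v ≟ v
... | yes _  = refl
... | no v≢v = contradiction refl v≢v

complete-arc : ∀ {u v : Fin n} → u ≢ v → Arc (complete n) u v
complete-arc {u = u} {v} u≢v with u ≟ v
... | yes u≡v = contradiction u≡v u≢v
... | no _    = refl

complete-stronglyConnected : StronglyConnected (complete n)
complete-stronglyConnected u v with u ≟ v
... | yes refl = stop
... | no u≢v   = step (complete-arc u≢v) stop

complete-μ : MuIs (complete n) n
complete-μ {n} = (⊤ , adjacent⇒isMutualVisibility complete-arc ⊤ , ∣⊤∣≡n n) , λ S _ → ∣p∣≤n S

third : ∀ {m} (u v : Fin (3 + m)) → Σ (Fin (3 + m)) λ w → w ≢ u × w ≢ v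
third zero          zero          = suc zero , (λ ()) , (λ ())
third zero          (suc zero)    = suc (suc zero) , (λ ()) , (λ ())
third zero          (suc (suc _)) = suc zero , (λ ()) , (λ ())
third (suc zero)    zero          = suc (suc zero) , (λ ()) , (λ ())
third (suc (suc _)) zero          = suc zero , (λ ()) , (λ ())
third (suc _)       (suc _)       = zero , (λ ()) , (λ ())

deleteArc-complete-arc : ∀ {a b x y : Fin n} → x ≢ y → ¬ (x ≡ a × y ≡ b) → Arc (deleteArc (complete n) a b) x y
deleteArc-complete-arc x≢y = deleteArc⁺ {D = complete _} (complete-arc x≢y)

deleteArc-complete-stronglyConnected : ∀ {m} (a b : Fin (3 + m)) →
  StronglyConnected (deleteArc (complete (3 + m)) a b)
deleteArc-complete-stronglyConnected a b u v with u ≟ v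
... | yes refl = stop
... | no u≢v with (u ≟ a) ×-dec (v ≟ b)
...   | no ¬ab = step (deleteArc-complete-arc u≢v ¬ab) stop
...   | yes (refl , refl) with w , w≢u , w≢v ← third u v =
  step (deleteArc-complete-arc (w≢u ∘ sym) (w≢v ∘ proj₂)) (step (deleteArc-complete-arc w≢v (w≢u ∘ proj₁)) stop)

complete-β : ∀ {m} → BetaIs (complete (3 + m)) 0
complete-β = [] , [] , (λ a b → (λ ()) , λ bridge → contradiction bridge (no-bridge a b)) , refl
  where
    no-bridge : ∀ a b → ¬ IsStrongBridge (complete _) a b
    no-bridge a b =
      stronglyConnected⇒¬IsStrongBridge complete-stronglyConnected (deleteArc-complete-stronglyConnected a b)

mainTheorem6 :
    (Σ ℕ λ c → ∀ (N : ℕ) → Σ ℕ λ n → Σ (Digraph n) λ D →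
        StronglyConnected D × (Σ ℕ λ b → BetaIs D b × N ≤ b) × MuIs D c)
    ×
    (Σ ℕ λ c' → ∀ (N : ℕ) → Σ ℕ λ n → Σ (Digraph n) λ D →
        StronglyConnected D × BetaIs D c' × (Σ ℕ λ m → MuIs D m × N ≤ m))
mainTheorem6 =
  (2 , λ N → let open DirectedCycle N in
    _ , C , C-stronglyConnected , (_ , C-β , m≤n+m N 2) , C-μ) ,
  (0 , λ N →
    _ , complete (3 + N) , complete-stronglyConnected , complete-β , _ , complete-μ , m≤n+m N 3)
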